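{- Let $\ell\leqslant k\leqslant n$ be positive integers and let $M$ be the 0/1-matrix with rows indexed by $\{S\subseteq[n]: |S|\leqslant k\}$ and columns indexed by $\{T\subseteq[n]: |T|\leqslant\ell\}$, where $M_{S,T}\neq 0$ if and only if $S\cap T=\varnothing$. Then $\mathrm{rc}(M)=O\big((k+\ell)e^{\ell}(1+k/\ell)^{\ell}\log n\big)$.
   Context: For a real matrix $M$, a rectangle covering is a set of rectangles $I\times J$ (row index set times column index set), each contained in $\mathrm{supp}(M)=\{(i,j):M_{i,j}\neq0\}$, whose union is $\mathrm{supp}(M)$; the rectangle covering number $\mathrm{rc}(M)$ is the minimum size of one. The $O$ hides an absolute constant. -}

module Defs where

open import Data.Nat using (ℕ; _≤_)
open import Data.Bool using (Bool; T)
open import Data.Product using (_×_; _,_; ∃-syntax)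
open import Data.List using (List)
open import Data.List.Membership.Propositional using (_∈_)
open import Data.Fin.Subset using (Subset; ∣_∣; _∩_; Empty)

-- M is the 0/1 matrix with M_{S,T} ≠ 0 iff S ∩ T = ∅, so
-- supp(M) = {(S,T) : S a row index, T a column index, S ∩ T = ∅}.
Supp : (n k ℓ : ℕ) → Subset n → Subset n → Set
Supp n k ℓ S U = (∣ S ∣ ≤ k) × (∣ U ∣ ≤ ℓ) × Empty (S ∩ U)

record Rect (n : ℕ) : Set where
  constructor rect
  field
    rowSet : Subset n → Bool
    colSet : Subset n → Bool
open Rect public

InRect : ∀ {n} → Rect n → Subset n → Subset n → Set
InRect R S U = T (rowSet R S) × T (colSet R U)

IsRectCovering : (n k ℓ : ℕ) → List (Rect n) → Set
IsRectCovering n k ℓ rs =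
  (∀ R → R ∈ rs → ∀ S U → InRect R S U → Supp n k ℓ S U)
  × (∀ S U → Supp n k ℓ S U → ∃[ R ] (R ∈ rs × InRect R S U))

-- Colour the points of [n] independently, each on the row side with probability k/(k+ℓ).
-- A colouring c yields the rectangle of all rows S ⊆ c, |S| ≤ k, times all columns
-- U ⊆ ∁ c, |U| ≤ ℓ, which lies in supp(M); a support entry (S , U) falls into it with
-- probability (k/(k+ℓ))^|S| (ℓ/(k+ℓ))^|U| ≥ 1/ρ, where ρ = (k+ℓ)^(k+ℓ)/(k^k ℓ^ℓ).
-- By averaging, some colouring covers a 1/ρ fraction of any set of support entries, so
-- the greedy cover shrinks the uncovered entries geometrically: O(ρ) rounds halve them,
-- and as there are at most (n+1)^(k+ℓ) entries, O(ρ (k+ℓ) log n) colourings suffice.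
-- Finally ρ = (1+ℓ/k)^k (1+k/ℓ)^ℓ ≤ 4 (1+1/ℓ)^(ℓ·ℓ) (1+k/ℓ)^ℓ, the elementary form of
-- e^ℓ (1+k/ℓ)^ℓ, because (1+1/m)^(m+1) decreases in m.

module Submission where

open import Defs
open import Data.Nat using (ℕ; _≤_; _+_; _*_; _^_)
open import Data.Nat.Logarithm using (⌊log₂_⌋)
open import Data.Product using (_×_; ∃-syntax)
open import Data.List using (List; length)

open import Data.Nat
open import Data.Nat.Properties
open import Data.Nat.Tactic.RingSolver using (solve-∀)
open import Data.Nat.DivMod using (m≡m%n+[m/n]*n; m%n<n; m/n*n≤m)
open import Data.Nat.Logarithm using (⌊log₂⌋-mono-≤; ⌊log₂[2^n]⌋≡n)
open import Data.Nat.ListAction using (sum)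
open import Data.Nat.ListAction.Properties using (sum-++)
open import Data.Bool using (Bool; true; false; not; _∧_; _∨_; T)
open import Data.Bool.Properties using (T-∧; ∧-zeroʳ)
open import Data.List using ([]; _∷_; map; _++_; replicate; filter; cartesianProductWith; cartesianProduct)
open import Data.List.Properties
  using (length-++; length-map; length-replicate; length-filter; map-++; map-∘; map-cong)
open import Data.List.Relation.Unary.All using (All; []; _∷_; tabulate)
open import Data.List.Relation.Unary.Any using (Any; here; there)
open import Data.List.Membership.Propositional using (_∈_)
open import Data.List.Membership.Propositional.Properties
  using (∈-map⁺; ∈-map⁻; ∈-++⁺ˡ; ∈-++⁺ʳ; ∈-filter⁺; ∈-filter⁻; ∈-cartesianProduct⁺)
open import Data.List.Extrema.Nat using (argmax; f[⊥]≤f[argmax]; f[xs]≤f[argmax])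
open import Data.Fin using (zero; suc)
open import Data.Fin.Subset using (Subset; ∣_∣; _∩_; ∁; Empty; inside; outside)
open import Data.Fin.Subset.Properties using (drop-∷-Empty; nonempty?)
open import Data.Vec using ([]; _∷_; here; there)
open import Data.Product using (_,_; proj₁; proj₂)
open import Data.Sum using (_⊎_; inj₁; inj₂; fromInj₁)
open import Data.Empty using (⊥-elim)
open import Function using (_∘_)
open import Function.Bundles using (Equivalence)
open import Relation.Binary.PropositionalEquality
open import Relation.Nullary using (contradiction)
open import Relation.Nullary.Decidable using (Dec; yes; no; T?; ¬?; _×-dec_)
open import Algebra.Properties.CommutativeSemigroup +-commutativeSemigroup
  using () renaming (interchange to +-interchange)
open import Algebra.Properties.CommutativeSemigroup *-commutativeSemigroup
  using () renaming (interchange to *-interchange)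

^-distribʳ-* : ∀ m n o → (m * n) ^ o ≡ m ^ o * n ^ o
^-distribʳ-* m n zero    = refl
^-distribʳ-* m n (suc o) = begin
  m * n * (m * n) ^ o       ≡⟨ cong (m * n *_) (^-distribʳ-* m n o) ⟩
  m * n * (m ^ o * n ^ o)   ≡⟨ *-interchange m n (m ^ o) (n ^ o) ⟩
  m * m ^ o * (n * n ^ o)   ∎
  where open ≡-Reasoning

*-mono-^ : ∀ {a b c d} m → a * b ≤ c * d → a ^ m * b ^ m ≤ c ^ m * d ^ m
*-mono-^ {a} {b} {c} {d} m ab≤cd = begin
  a ^ m * b ^ m   ≡⟨ ^-distribʳ-* a b m ⟨
  (a * b) ^ m     ≤⟨ ^-monoˡ-≤ m ab≤cd ⟩
  (c * d) ^ m     ≡⟨ ^-distribʳ-* c d m ⟩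
  c ^ m * d ^ m   ∎
  where open ≤-Reasoning

-- Inequalities between ratios are stated with denominators cleared (a/b ≤ c/d as
-- a * d ≤ c * b) and named after the ratios; this is transitivity for ratios.
*-cross-≤-trans : ∀ {a b c d e f} .{{_ : NonZero d}} →
                  a * d ≤ c * b → c * f ≤ e * d → a * f ≤ e * b
*-cross-≤-trans {a} {b} {c} {d} {e} {f} ad≤cb cf≤ed = *-cancelʳ-≤ (a * f) (e * b) d (begin
  a * f * d     ≡⟨ swap₂₃ a f d ⟩
  a * d * f     ≤⟨ *-monoˡ-≤ f ad≤cb ⟩
  c * b * f     ≡⟨ swap₂₃ c b f ⟩
  c * f * b     ≤⟨ *-monoˡ-≤ b cf≤ed ⟩
  e * d * b     ≡⟨ swap₂₃ e d b ⟩
  e * b * d     ∎)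
  where
  open ≤-Reasoning
  swap₂₃ : ∀ x y z → x * y * z ≡ x * z * y
  swap₂₃ = solve-∀

bernoulli : ∀ e p n → e ^ suc n + suc n * p * e ^ n ≤ (e + p) ^ suc n
bernoulli e p zero = ≤-reflexive (base e p)
  where
  base : ∀ e p → e * 1 + (p + 0) * 1 ≡ (e + p) * 1
  base = solve-∀
bernoulli e p (suc n) = begin
  e * (e * E) + suc (suc n) * p * (e * E)                       ≤⟨ m≤m+n _ _ ⟩
  e * (e * E) + suc (suc n) * p * (e * E) + suc n * p * p * E   ≡⟨ expand e p n E ⟩
  (e + p) * (e * E + suc n * p * E)                             ≤⟨ *-monoʳ-≤ (e + p) (bernoulli e p n) ⟩
  (e + p) * (e + p) ^ suc n                                     ∎
  where
  open ≤-Reasoning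
  E : ℕ
  E = e ^ n
  expand : ∀ e p n E → e * (e * E) + suc (suc n) * p * (e * E) + suc n * p * p * E
                     ≡ (e + p) * (e * E + suc n * p * E)
  expand = solve-∀

-- Bernoulli's inequality for (1 + 1/(b(b+2)))^(b+1), as (b+1)² = b(b+2) + 1.
[1+1/n]^[1+n]-step : ∀ b → suc (suc b) ^ suc (suc b) * b ^ suc b ≤ suc b ^ suc b * suc b ^ suc (suc b)
[1+1/n]^[1+n]-step b = begin
  suc (suc b) ^ suc (suc b) * b ^ suc b            ≡⟨ lhs-form ⟩
  b * suc (suc b) * suc (suc b) * x ^ b            ≤⟨ *-monoˡ-≤ (x ^ b) (m≤m+n (b * suc (suc b) * suc (suc b)) 1) ⟩
  (b * suc (suc b) * suc (suc b) + 1) * x ^ b      ≡⟨ expand b (x ^ b) ⟩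
  suc b * (x ^ suc b + suc b * 1 * x ^ b)          ≤⟨ *-monoʳ-≤ (suc b) (bernoulli x 1 b) ⟩
  suc b * (x + 1) ^ suc b                          ≡⟨ rhs-form ⟩
  suc b ^ suc b * suc b ^ suc (suc b)              ∎
  where
  open ≤-Reasoning
  x : ℕ
  x = b * suc (suc b)
  expand : ∀ b X → (b * suc (suc b) * suc (suc b) + 1) * X
                 ≡ suc b * (b * suc (suc b) * X + suc b * 1 * X)
  expand = solve-∀
  lhs-form : suc (suc b) ^ suc (suc b) * b ^ suc b ≡ b * suc (suc b) * suc (suc b) * x ^ b
  lhs-form = begin-equality
    suc (suc b) * (suc (suc b) * B₂) * (b * B₀)   ≡⟨ regroup (suc (suc b)) b B₂ B₀ ⟩
    b * suc (suc b) * suc (suc b) * (B₀ * B₂)     ≡⟨ cong (b * suc (suc b) * suc (suc b) *_) (^-distribʳ-* b (suc (suc b)) b) ⟨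
    b * suc (suc b) * suc (suc b) * x ^ b         ∎
    where
    B₂ B₀ : ℕ
    B₂ = suc (suc b) ^ b
    B₀ = b ^ b
    regroup : ∀ c b X Y → c * (c * X) * (b * Y) ≡ b * c * c * (Y * X)
    regroup = solve-∀
  rhs-form : suc b * (x + 1) ^ suc b ≡ suc b ^ suc b * suc b ^ suc (suc b)
  rhs-form = begin-equality
    suc b * (x + 1) ^ suc b                     ≡⟨ cong (λ y → suc b * y ^ suc b) (square b) ⟩
    suc b * (suc b * suc b) ^ suc b             ≡⟨ cong (suc b *_) (^-distribʳ-* (suc b) (suc b) (suc b)) ⟩
    suc b * (suc b ^ suc b * suc b ^ suc b)     ≡⟨ regroup (suc b) (suc b ^ suc b) ⟩
    suc b ^ suc b * (suc b * suc b ^ suc b)     ∎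
    where
    square : ∀ b → b * suc (suc b) + 1 ≡ suc b * suc b
    square = solve-∀
    regroup : ∀ c Z → c * (Z * Z) ≡ Z * (c * Z)
    regroup = solve-∀

[1+1/n]^[1+n]-antitone : ∀ {a b} → 1 ≤ a → a ≤ b →
                         suc b ^ suc b * a ^ suc a ≤ suc a ^ suc a * b ^ suc b
[1+1/n]^[1+n]-antitone {a} 1≤a a≤b = go (≤⇒≤′ a≤b)
  where
  go : ∀ {b} → a ≤′ b → suc b ^ suc b * a ^ suc a ≤ suc a ^ suc a * b ^ suc b
  go ≤′-refl = ≤-refl
  go {suc c} (≤′-step a≤c) =
    *-cross-≤-trans {suc (suc c) ^ suc (suc c)} {suc c ^ suc (suc c)} {suc c ^ suc c} {c ^ suc c}
                    {suc a ^ suc a} {a ^ suc a}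
                    {{m^n≢0 c (suc c) {{>-nonZero (≤-trans 1≤a (≤′⇒≤ a≤c))}}}}
                    ([1+1/n]^[1+n]-step c) (go a≤c)

[1+1/k]^k≤[1+1/ℓ]^[1+ℓ] : ∀ {k ℓ} → 1 ≤ ℓ → ℓ ≤ k → suc k ^ k * ℓ ^ suc ℓ ≤ suc ℓ ^ suc ℓ * k ^ k
[1+1/k]^k≤[1+1/ℓ]^[1+ℓ] {k} {ℓ} 1≤ℓ ℓ≤k =
  *-cross-≤-trans {suc k ^ k} {k ^ k} {suc k ^ suc k} {k ^ suc k} {suc ℓ ^ suc ℓ} {ℓ ^ suc ℓ}
                  {{m^n≢0 k (suc k) {{>-nonZero (≤-trans 1≤ℓ ℓ≤k)}}}}
                  [1+1/k]^k≤[1+1/k]^[1+k] ([1+1/n]^[1+n]-antitone 1≤ℓ ℓ≤k)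
  where
  [1+1/k]^k≤[1+1/k]^[1+k] : suc k ^ k * k ^ suc k ≤ suc k ^ suc k * k ^ k
  [1+1/k]^k≤[1+1/k]^[1+k] = begin
    suc k ^ k * (k * k ^ k)     ≡⟨ regroup k (suc k ^ k) (k ^ k) ⟩
    k * (suc k ^ k * k ^ k)     ≤⟨ *-monoˡ-≤ (suc k ^ k * k ^ k) (n≤1+n k) ⟩
    suc k * (suc k ^ k * k ^ k) ≡⟨ *-assoc (suc k) (suc k ^ k) (k ^ k) ⟨
    suc k * suc k ^ k * k ^ k   ∎
    where
    open ≤-Reasoning
    regroup : ∀ k X Y → X * (k * Y) ≡ k * (X * Y)
    regroup = solve-∀

[1+1/ℓ]^ℓ≤4 : ∀ {ℓ} → 1 ≤ ℓ → suc ℓ ^ ℓ ≤ 4 * ℓ ^ ℓ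
[1+1/ℓ]^ℓ≤4 {ℓ} 1≤ℓ = *-cancelʳ-≤ (suc ℓ ^ ℓ) (4 * ℓ ^ ℓ) (suc ℓ) (begin
  suc ℓ ^ ℓ * suc ℓ               ≡⟨ regroup (suc ℓ) (suc ℓ ^ ℓ) ⟩
  suc ℓ ^ suc ℓ * 1 ^ 2           ≤⟨ [1+1/n]^[1+n]-antitone ≤-refl 1≤ℓ ⟩
  4 * ℓ ^ suc ℓ                   ≡⟨ *-assoc 4 ℓ (ℓ ^ ℓ) ⟨
  4 * ℓ * ℓ ^ ℓ                   ≡⟨ regroup′ ℓ (ℓ ^ ℓ) ⟩
  4 * ℓ ^ ℓ * ℓ                   ≤⟨ *-monoʳ-≤ (4 * ℓ ^ ℓ) (n≤1+n ℓ) ⟩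
  4 * ℓ ^ ℓ * suc ℓ               ∎)
  where
  open ≤-Reasoning
  regroup : ∀ c X → X * c ≡ c * X * 1
  regroup = solve-∀
  regroup′ : ∀ ℓ X → 4 * ℓ * X ≡ 4 * X * ℓ
  regroup′ = solve-∀

[k+ℓ]*k^ℓ≤[1+k]^ℓ*k : ∀ k ℓ → (k + ℓ) * k ^ ℓ ≤ suc k ^ ℓ * k
[k+ℓ]*k^ℓ≤[1+k]^ℓ*k k zero    = ≤-reflexive (base k)
  where
  base : ∀ k → (k + 0) * 1 ≡ 1 * k
  base = solve-∀
[k+ℓ]*k^ℓ≤[1+k]^ℓ*k k (suc n) = begin
  (k + suc n) * (k * k ^ n)            ≡⟨ regroup k n (k ^ n) ⟩
  k * (k ^ suc n + suc n * 1 * k ^ n)  ≤⟨ *-monoʳ-≤ k (bernoulli k 1 n) ⟩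
  k * (k + 1) ^ suc n                  ≡⟨ cong (λ m → k * m ^ suc n) (+-comm k 1) ⟩
  k * suc k ^ suc n                    ≡⟨ *-comm k (suc k ^ suc n) ⟩
  suc k ^ suc n * k                    ∎
  where
  open ≤-Reasoning
  regroup : ∀ k n X → (k + suc n) * (k * X) ≡ k * (k * X + suc n * 1 * X)
  regroup = solve-∀

[1+ℓ/k]^k≤4[1+1/ℓ]^[ℓℓ] : ∀ {k ℓ} → 1 ≤ ℓ → ℓ ≤ k →
                          (k + ℓ) ^ k * ℓ ^ (ℓ * ℓ) ≤ 4 * suc ℓ ^ (ℓ * ℓ) * k ^ k
[1+ℓ/k]^k≤4[1+1/ℓ]^[ℓℓ] {k} {ℓ} 1≤ℓ ℓ≤k =
  *-cross-≤-trans {(k + ℓ) ^ k} {k ^ k} {(suc ℓ ^ suc ℓ) ^ ℓ} {(ℓ ^ suc ℓ) ^ ℓ}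
                  {4 * suc ℓ ^ (ℓ * ℓ)} {ℓ ^ (ℓ * ℓ)} {{m^n≢0 (ℓ ^ suc ℓ) ℓ {{m^n≢0 ℓ (suc ℓ) {{ℓ≢0}} }} }}
    (*-cross-≤-trans {(k + ℓ) ^ k} {k ^ k} {(suc k ^ k) ^ ℓ} {(k ^ k) ^ ℓ}
                     {(suc ℓ ^ suc ℓ) ^ ℓ} {(ℓ ^ suc ℓ) ^ ℓ} {{m^n≢0 (k ^ k) ℓ {{m^n≢0 k k {{k≢0}} }} }}
                     [1+ℓ/k]^k≤[1+1/k]^[kℓ]
                     (*-mono-^ ℓ ([1+1/k]^k≤[1+1/ℓ]^[1+ℓ] 1≤ℓ ℓ≤k)))
    [1+1/ℓ]^[ℓ+ℓℓ]≤4[1+1/ℓ]^[ℓℓ]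
  where
  open ≤-Reasoning
  ℓ≢0 : NonZero ℓ
  ℓ≢0 = >-nonZero 1≤ℓ
  k≢0 : NonZero k
  k≢0 = >-nonZero (≤-trans 1≤ℓ ℓ≤k)
  ^-comm : ∀ m a b → (m ^ a) ^ b ≡ (m ^ b) ^ a
  ^-comm m a b = trans (^-*-assoc m a b) (trans (cong (m ^_) (*-comm a b)) (sym (^-*-assoc m b a)))
  [1+ℓ/k]^k≤[1+1/k]^[kℓ] : (k + ℓ) ^ k * (k ^ k) ^ ℓ ≤ (suc k ^ k) ^ ℓ * k ^ k
  [1+ℓ/k]^k≤[1+1/k]^[kℓ] = begin
    (k + ℓ) ^ k * (k ^ k) ^ ℓ       ≡⟨ cong ((k + ℓ) ^ k *_) (^-comm k k ℓ) ⟩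
    (k + ℓ) ^ k * (k ^ ℓ) ^ k       ≤⟨ *-mono-^ k ([k+ℓ]*k^ℓ≤[1+k]^ℓ*k k ℓ) ⟩
    (suc k ^ ℓ) ^ k * k ^ k         ≡⟨ cong (_* k ^ k) (^-comm (suc k) ℓ k) ⟩
    (suc k ^ k) ^ ℓ * k ^ k         ∎
  [1+1/ℓ]^[ℓ+ℓℓ]≤4[1+1/ℓ]^[ℓℓ] : (suc ℓ ^ suc ℓ) ^ ℓ * ℓ ^ (ℓ * ℓ) ≤ 4 * suc ℓ ^ (ℓ * ℓ) * (ℓ ^ suc ℓ) ^ ℓ
  [1+1/ℓ]^[ℓ+ℓℓ]≤4[1+1/ℓ]^[ℓℓ] = begin
    (suc ℓ ^ suc ℓ) ^ ℓ * ℓ ^ (ℓ * ℓ)         ≡⟨ cong (_* ℓ ^ (ℓ * ℓ)) (split (suc ℓ)) ⟩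
    suc ℓ ^ ℓ * suc ℓ ^ (ℓ * ℓ) * ℓ ^ (ℓ * ℓ) ≤⟨ *-monoˡ-≤ (ℓ ^ (ℓ * ℓ)) (*-monoˡ-≤ (suc ℓ ^ (ℓ * ℓ)) ([1+1/ℓ]^ℓ≤4 1≤ℓ)) ⟩
    4 * ℓ ^ ℓ * suc ℓ ^ (ℓ * ℓ) * ℓ ^ (ℓ * ℓ) ≡⟨ regroup (ℓ ^ ℓ) (suc ℓ ^ (ℓ * ℓ)) (ℓ ^ (ℓ * ℓ)) ⟩
    4 * suc ℓ ^ (ℓ * ℓ) * (ℓ ^ ℓ * ℓ ^ (ℓ * ℓ)) ≡⟨ cong (4 * suc ℓ ^ (ℓ * ℓ) *_) (split ℓ) ⟨
    4 * suc ℓ ^ (ℓ * ℓ) * (ℓ ^ suc ℓ) ^ ℓ     ∎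
    where
    split : ∀ m → (m ^ suc ℓ) ^ ℓ ≡ m ^ ℓ * m ^ (ℓ * ℓ)
    split m = trans (^-*-assoc m (suc ℓ) ℓ) (^-distribˡ-+-* m ℓ (ℓ * ℓ))
    regroup : ∀ A B C → 4 * A * B * C ≡ 4 * B * (A * C)
    regroup = solve-∀

2*e^r≤[p+e]^r : ∀ {p e} r → 1 ≤ p + e → p + e ≤ r * p → 2 * e ^ r ≤ (p + e) ^ r
2*e^r≤[p+e]^r         zero    1≤p+e p+e≤0  = contradiction (≤-trans 1≤p+e p+e≤0) λ ()
2*e^r≤[p+e]^r {p} {e} (suc r) _     p+e≤rp = begin
  2 * e ^ suc r                   ≡⟨ double e (e ^ r) ⟩
  e ^ suc r + e * e ^ r           ≤⟨ +-monoʳ-≤ (e ^ suc r) (*-monoˡ-≤ (e ^ r) (≤-trans (m≤n+m e p) p+e≤rp)) ⟩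
  e ^ suc r + suc r * p * e ^ r   ≤⟨ bernoulli e p r ⟩
  (e + p) ^ suc r                 ≡⟨ cong (_^ suc r) (+-comm e p) ⟩
  (p + e) ^ suc r                 ∎
  where
  open ≤-Reasoning
  double : ∀ e E → 2 * (e * E) ≡ e * E + e * E
  double = solve-∀

e^[r*h]*u<[p+e]^[r*h] : ∀ {p e u} r h → 1 ≤ p + e → p + e ≤ r * p → u < 2 ^ h →
                        e ^ (r * h) * u < (p + e) ^ (r * h)
e^[r*h]*u<[p+e]^[r*h] {p} {e} {u} r h 1≤p+e p+e≤rp u<2^h = *-cancelˡ-< (2 ^ h) _ _ (begin-strict
  2 ^ h * (e ^ (r * h) * u)     ≡⟨ *-assoc (2 ^ h) (e ^ (r * h)) u ⟨
  2 ^ h * e ^ (r * h) * u       ≤⟨ *-monoˡ-≤ u 2^h*e^[rh]≤Q^[rh] ⟩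
  Q ^ (r * h) * u               <⟨ *-monoʳ-< (Q ^ (r * h)) {{m^n≢0 Q (r * h) {{>-nonZero 1≤p+e}}}} u<2^h ⟩
  Q ^ (r * h) * 2 ^ h           ≡⟨ *-comm (Q ^ (r * h)) (2 ^ h) ⟩
  2 ^ h * Q ^ (r * h)           ∎)
  where
  open ≤-Reasoning
  Q : ℕ
  Q = p + e
  2^h*e^[rh]≤Q^[rh] : 2 ^ h * e ^ (r * h) ≤ Q ^ (r * h)
  2^h*e^[rh]≤Q^[rh] = begin
    2 ^ h * e ^ (r * h)     ≡⟨ cong (2 ^ h *_) (^-*-assoc e r h) ⟨
    2 ^ h * (e ^ r) ^ h     ≡⟨ ^-distribʳ-* 2 (e ^ r) h ⟨
    (2 * e ^ r) ^ h         ≤⟨ ^-monoˡ-≤ h (2*e^r≤[p+e]^r r 1≤p+e p+e≤rp) ⟩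
    (Q ^ r) ^ h             ≡⟨ ^-*-assoc Q r h ⟩
    Q ^ (r * h)             ∎

m<[1+m/n]*n : ∀ m n .{{_ : NonZero n}} → m < suc (m / n) * n
m<[1+m/n]*n m n = begin-strict
  m                   ≡⟨ m≡m%n+[m/n]*n m n ⟩
  m % n + m / n * n   <⟨ +-monoˡ-< (m / n * n) (m%n<n m n) ⟩
  n + m / n * n       ∎
  where open ≤-Reasoning

[1+m/n]*n≤n+m : ∀ m n .{{_ : NonZero n}} → suc (m / n) * n ≤ n + m
[1+m/n]*n≤n+m m n = +-monoʳ-≤ n (m/n*n≤m m n)

n<2^[1+⌊log₂n⌋] : ∀ n → n < 2 ^ suc ⌊log₂ n ⌋
n<2^[1+⌊log₂n⌋] n with n <? 2 ^ suc ⌊log₂ n ⌋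
... | yes n<2^[1+L] = n<2^[1+L]
... | no  n≮2^[1+L] = contradiction (begin
  suc ⌊log₂ n ⌋                    ≡⟨ ⌊log₂[2^n]⌋≡n (suc ⌊log₂ n ⌋) ⟨
  ⌊log₂ 2 ^ suc ⌊log₂ n ⌋ ⌋        ≤⟨ ⌊log₂⌋-mono-≤ (≮⇒≥ n≮2^[1+L]) ⟩
  ⌊log₂ n ⌋                        ∎) 1+n≰n
  where open ≤-Reasoning

1≤⌊log₂n⌋ : ∀ {n} → 2 ≤ n → 1 ≤ ⌊log₂ n ⌋
1≤⌊log₂n⌋ 2≤n = ≤-trans (≤-reflexive (sym (⌊log₂[2^n]⌋≡n 1))) (⌊log₂⌋-mono-≤ 2≤n)

m*[1+n]+1≤3*[m*n] : ∀ {m n} → 1 ≤ m → 1 ≤ n → m * suc n + 1 ≤ 3 * (m * n)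
m*[1+n]+1≤3*[m*n] {m} {n} 1≤m 1≤n = begin
  m * suc n + 1          ≤⟨ +-monoʳ-≤ (m * suc n) (*-mono-≤ 1≤m 1≤n) ⟩
  m * suc n + m * n      ≡⟨ expand m n ⟩
  m + m * n + m * n      ≤⟨ +-monoˡ-≤ (m * n) (+-monoˡ-≤ (m * n) (m≤m*n m n {{>-nonZero 1≤n}})) ⟩
  m * n + m * n + m * n  ≡⟨ triple (m * n) ⟩
  3 * (m * n)            ∎
  where
  open ≤-Reasoning
  expand : ∀ m n → m * suc n + m * n ≡ m + m * n + m * n
  expand = solve-∀
  triple : ∀ x → x + x + x ≡ 3 * x
  triple = solve-∀

rounds*height-bound : ∀ {k ℓ r h L} → 1 ≤ ℓ → ℓ ≤ k →
             r * (k ^ k * ℓ ^ ℓ) ≤ 2 * (k + ℓ) ^ (k + ℓ) → h ≤ 3 * ((k + ℓ) * L) →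
             r * h * ℓ ^ (ℓ * ℓ + ℓ) ≤ 24 * ((k + ℓ) * (ℓ + 1) ^ (ℓ * ℓ) * (k + ℓ) ^ ℓ * L)
rounds*height-bound {k} {ℓ} {r} {h} {L} 1≤ℓ ℓ≤k rp≤2Q h≤3DL = *-cancelˡ-≤ (k ^ k) {{m^n≢0 k k {{>-nonZero (≤-trans 1≤ℓ ℓ≤k)}}}} (begin
  k ^ k * (r * h * ℓ ^ (ℓ * ℓ + ℓ))
    ≡⟨ cong (λ x → k ^ k * (r * h * x)) (^-distribˡ-+-* ℓ (ℓ * ℓ) ℓ) ⟩
  k ^ k * (r * h * (ℓ ^ (ℓ * ℓ) * ℓ ^ ℓ))
    ≡⟨ regroup₁ (k ^ k) r h (ℓ ^ (ℓ * ℓ)) (ℓ ^ ℓ) ⟩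
  r * (k ^ k * ℓ ^ ℓ) * (h * ℓ ^ (ℓ * ℓ))
    ≤⟨ *-monoˡ-≤ (h * ℓ ^ (ℓ * ℓ)) rp≤2Q ⟩
  2 * D ^ (k + ℓ) * (h * ℓ ^ (ℓ * ℓ))
    ≡⟨ cong (λ x → 2 * x * (h * ℓ ^ (ℓ * ℓ))) (^-distribˡ-+-* D k ℓ) ⟩
  2 * (D ^ k * D ^ ℓ) * (h * ℓ ^ (ℓ * ℓ))
    ≡⟨ regroup₂ (D ^ k) (D ^ ℓ) h (ℓ ^ (ℓ * ℓ)) ⟩
  2 * h * D ^ ℓ * (D ^ k * ℓ ^ (ℓ * ℓ))
    ≤⟨ *-monoʳ-≤ (2 * h * D ^ ℓ) ([1+ℓ/k]^k≤4[1+1/ℓ]^[ℓℓ] 1≤ℓ ℓ≤k) ⟩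
  2 * h * D ^ ℓ * (4 * suc ℓ ^ (ℓ * ℓ) * k ^ k)
    ≤⟨ *-monoˡ-≤ (4 * suc ℓ ^ (ℓ * ℓ) * k ^ k) (*-monoˡ-≤ (D ^ ℓ) (*-monoʳ-≤ 2 h≤3DL)) ⟩
  2 * (3 * (D * L)) * D ^ ℓ * (4 * suc ℓ ^ (ℓ * ℓ) * k ^ k)
    ≡⟨ regroup₃ D L (D ^ ℓ) (suc ℓ ^ (ℓ * ℓ)) (k ^ k) ⟩
  k ^ k * (24 * (D * suc ℓ ^ (ℓ * ℓ) * D ^ ℓ * L))
    ≡⟨ cong (λ x → k ^ k * (24 * (D * x ^ (ℓ * ℓ) * D ^ ℓ * L))) (+-comm 1 ℓ) ⟩
  k ^ k * (24 * (D * (ℓ + 1) ^ (ℓ * ℓ) * D ^ ℓ * L))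
    ∎)
  where
  open ≤-Reasoning
  D : ℕ
  D = k + ℓ
  regroup₁ : ∀ K r h A B → K * (r * h * (A * B)) ≡ r * (K * B) * (h * A)
  regroup₁ = solve-∀
  regroup₂ : ∀ A B h C → 2 * (A * B) * (h * C) ≡ 2 * h * B * (A * C)
  regroup₂ = solve-∀
  regroup₃ : ∀ D L B H K → 2 * (3 * (D * L)) * B * (4 * H * K) ≡ K * (24 * (D * H * B * L))
  regroup₃ = solve-∀

module _ {A : Set} where

  sum-map-+ : ∀ (f g : A → ℕ) xs → sum (map (λ x → f x + g x) xs) ≡ sum (map f xs) + sum (map g xs)
  sum-map-+ f g []       = refl
  sum-map-+ f g (x ∷ xs) = trans (cong (f x + g x +_) (sum-map-+ f g xs))
                                 (+-interchange (f x) (g x) _ _)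

  sum-map-*ˡ : ∀ c (f : A → ℕ) xs → sum (map (λ x → c * f x) xs) ≡ c * sum (map f xs)
  sum-map-*ˡ c f []       = sym (*-zeroʳ c)
  sum-map-*ˡ c f (x ∷ xs) = trans (cong (c * f x +_) (sum-map-*ˡ c f xs))
                                  (sym (*-distribˡ-+ c (f x) _))

  sum-map-const : ∀ c (xs : List A) → sum (map (λ _ → c) xs) ≡ length xs * c
  sum-map-const c []       = refl
  sum-map-const c (x ∷ xs) = cong (c +_) (sum-map-const c xs)

  sum-map-mono-≤ : ∀ {f g : A → ℕ} {xs} → All (λ x → f x ≤ g x) xs → sum (map f xs) ≤ sum (map g xs)
  sum-map-mono-≤ []         = z≤n
  sum-map-mono-≤ (fx≤gx ∷ h) = +-mono-≤ fx≤gx (sum-map-mono-≤ h)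

  sum-map-swap : ∀ {B : Set} (f : A → B → ℕ) xs ys →
                 sum (map (λ x → sum (map (f x) ys)) xs) ≡ sum (map (λ y → sum (map (λ x → f x y) xs)) ys)
  sum-map-swap f xs []       = trans (sum-map-const 0 xs) (*-zeroʳ (length xs))
  sum-map-swap f xs (y ∷ ys) = trans (sum-map-+ (λ x → f x y) (λ x → sum (map (f x) ys)) xs)
                                     (cong (sum (map (λ x → f x y) xs) +_) (sum-map-swap f xs ys))

  exists-≥-average : ∀ (f : A → ℕ) xs .{{_ : NonZero (length xs)}} → ∃[ x ] sum (map f xs) ≤ length xs * f x
  exists-≥-average f (x₀ ∷ xs) = best , (begin
    sum (map f (x₀ ∷ xs))         ≤⟨ sum-map-mono-≤ (f[⊥]≤f[argmax] {f = f} x₀ xs ∷ f[xs]≤f[argmax] {f = f} x₀ xs) ⟩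
    sum (map (λ _ → f best) (x₀ ∷ xs)) ≡⟨ sum-map-const (f best) (x₀ ∷ xs) ⟩
    length (x₀ ∷ xs) * f best     ∎)
    where
    open ≤-Reasoning
    best : A
    best = argmax f x₀ xs

indicator : Bool → ℕ
indicator true  = 1
indicator false = 0

∧-∧-interchange : ∀ a b c d → (a ∧ b) ∧ (c ∧ d) ≡ (a ∧ c) ∧ (b ∧ d)
∧-∧-interchange true  b true  d = refl
∧-∧-interchange true  b false d = ∧-zeroʳ b
∧-∧-interchange false b c     d = refl

indicator-∧ : ∀ a b → indicator (a ∧ b) ≡ indicator a * indicator b
indicator-∧ true  b = sym (+-identityʳ (indicator b))
indicator-∧ false b = refl

module _ {A : Set} where

  countᵇ : (A → Bool) → List A → ℕ
  countᵇ f xs = sum (map (indicator ∘ f) xs)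

  countᵇ+length-filter-¬ : ∀ f xs → countᵇ f xs + length (filter (λ x → ¬? (T? (f x))) xs) ≡ length xs
  countᵇ+length-filter-¬ f []       = refl
  countᵇ+length-filter-¬ f (x ∷ xs) with f x
  ... | true  = cong suc (countᵇ+length-filter-¬ f xs)
  ... | false = trans (+-suc _ _) (cong suc (countᵇ+length-filter-¬ f xs))

  countᵇ-++ : ∀ (f : A → Bool) xs ys → countᵇ f (xs ++ ys) ≡ countᵇ f xs + countᵇ f ys
  countᵇ-++ f xs ys = trans (cong sum (map-++ (indicator ∘ f) xs ys)) (sum-++ (map (indicator ∘ f) xs) _)

  countᵇ-replicate : ∀ (f : A → Bool) m x → countᵇ f (replicate m x) ≡ m * indicator (f x)
  countᵇ-replicate f zero    x = refl
  countᵇ-replicate f (suc m) x = cong (indicator (f x) +_) (countᵇ-replicate f m x)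

module _ {A B C : Set} where

  length-cartesianProductWith : ∀ (f : A → B → C) xs ys →
                                length (cartesianProductWith f xs ys) ≡ length xs * length ys
  length-cartesianProductWith f []       ys = refl
  length-cartesianProductWith f (x ∷ xs) ys = begin
    length (map (f x) ys ++ cartesianProductWith f xs ys)          ≡⟨ length-++ (map (f x) ys) ⟩
    length (map (f x) ys) + length (cartesianProductWith f xs ys)  ≡⟨ cong₂ _+_ (length-map (f x) ys) (length-cartesianProductWith f xs ys) ⟩
    length ys + length xs * length ys                              ∎
    where open ≡-Reasoning

  countᵇ-cartesianProductWith : ∀ (f : A → B → C) (φ : C → Bool) (α : A → Bool) (β : B → Bool) →
                                (∀ x y → φ (f x y) ≡ α x ∧ β y) → ∀ xs ys →
                                countᵇ φ (cartesianProductWith f xs ys) ≡ countᵇ α xs * countᵇ β ys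
  countᵇ-cartesianProductWith f φ α β split []       ys = refl
  countᵇ-cartesianProductWith f φ α β split (x ∷ xs) ys = begin
    countᵇ φ (map (f x) ys ++ cartesianProductWith f xs ys)
      ≡⟨ countᵇ-++ φ (map (f x) ys) _ ⟩
    countᵇ φ (map (f x) ys) + countᵇ φ (cartesianProductWith f xs ys)
      ≡⟨ cong₂ _+_ row (countᵇ-cartesianProductWith f φ α β split xs ys) ⟩
    indicator (α x) * countᵇ β ys + countᵇ α xs * countᵇ β ys
      ≡⟨ *-distribʳ-+ (countᵇ β ys) (indicator (α x)) (countᵇ α xs) ⟨
    countᵇ α (x ∷ xs) * countᵇ β ys
      ∎
    where
    open ≡-Reasoning
    row : countᵇ φ (map (f x) ys) ≡ indicator (α x) * countᵇ β ys
    row = begin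
      sum (map (indicator ∘ φ) (map (f x) ys))            ≡⟨ cong sum (map-∘ ys) ⟨
      sum (map (indicator ∘ φ ∘ f x) ys)                  ≡⟨ cong sum (map-cong (λ y → trans (cong indicator (split x y)) (indicator-∧ (α x) (β y))) ys) ⟩
      sum (map (λ y → indicator (α x) * indicator (β y)) ys) ≡⟨ sum-map-*ˡ (indicator (α x)) (indicator ∘ β) ys ⟩
      indicator (α x) * countᵇ β ys                       ∎

module GreedyCover {P Y : Set} (covers : P → Y → Bool) (X : List P) (p e : ℕ) where

  degree : Y → ℕ
  degree y = countᵇ (λ x → covers x y) X

  gain : P → List Y → ℕ
  gain x U = countᵇ (covers x) U

  FractionallyCovered : List Y → Set
  FractionallyCovered U = ∀ y → y ∈ U → length X * p ≤ (p + e) * degree y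

  Covered : List P → Y → Set
  Covered L y = Any (λ x → T (covers x y)) L

  uncovered : P → List Y → List Y
  uncovered x U = filter (λ y → ¬? (T? (covers x y))) U

  uncovered-shrinks : ∀ x U → p * length U ≤ (p + e) * gain x U →
                      (p + e) * length (uncovered x U) ≤ e * length U
  uncovered-shrinks x U good = +-cancelˡ-≤ ((p + e) * gain x U) _ _ (begin
    (p + e) * gain x U + (p + e) * length (uncovered x U) ≡⟨ *-distribˡ-+ (p + e) (gain x U) _ ⟨
    (p + e) * (gain x U + length (uncovered x U))         ≡⟨ cong ((p + e) *_) (countᵇ+length-filter-¬ (covers x) U) ⟩
    (p + e) * length U                                     ≡⟨ *-distribʳ-+ (length U) p e ⟩
    p * length U + e * length U                            ≤⟨ +-monoˡ-≤ (e * length U) good ⟩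
    (p + e) * gain x U + e * length U                      ∎)
    where open ≤-Reasoning

  module _ .{{_ : NonZero (length X)}} where

    exists-good-candidate : ∀ U → FractionallyCovered U → ∃[ x ] p * length U ≤ (p + e) * gain x U
    exists-good-candidate U hyp with exists-≥-average (λ x → gain x U) X
    ... | x , total≤N*gain = x , *-cancelˡ-≤ N (begin
      N * (p * length U)                 ≡⟨ regroup N p (length U) ⟩
      length U * (N * p)                 ≡⟨ sum-map-const (N * p) U ⟨
      sum (map (λ _ → N * p) U)          ≤⟨ sum-map-mono-≤ (tabulate (λ {y} → hyp y)) ⟩
      sum (map (λ y → Q * degree y) U)   ≡⟨ sum-map-*ˡ Q degree U ⟩
      Q * sum (map degree U)             ≡⟨ cong (Q *_) (sum-map-swap (λ x y → indicator (covers x y)) X U) ⟨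
      Q * sum (map (λ x → gain x U) X)   ≤⟨ *-monoʳ-≤ Q total≤N*gain ⟩
      Q * (N * gain x U)                 ≡⟨ swap Q N (gain x U) ⟩
      N * (Q * gain x U)                 ∎)
      where
      open ≤-Reasoning
      N Q : ℕ
      N = length X
      Q = p + e
      regroup : ∀ a b c → a * (b * c) ≡ c * (a * b)
      regroup = solve-∀
      swap : ∀ a b c → a * (b * c) ≡ b * (a * c)
      swap = solve-∀

    greedy : ∀ m U → FractionallyCovered U →
             ∃[ L ] ∃[ R ] (length L ≤ m × (∀ y → y ∈ U → Covered L y ⊎ y ∈ R)
                           × (p + e) ^ m * length R ≤ e ^ m * length U)
    greedy zero    U hyp = [] , U , z≤n , (λ _ → inj₂) , ≤-refl
    greedy (suc m) U hyp with exists-good-candidate U hyp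
    ... | x , good with greedy m (uncovered x U) (λ y y∈U′ → hyp y (proj₁ (∈-filter⁻ _ y∈U′)))
    ... | L , R , |L|≤m , covered , shrunk = x ∷ L , R , s≤s |L|≤m , covered′ , shrunk′
      where
      open ≤-Reasoning
      covered′ : ∀ y → y ∈ U → Covered (x ∷ L) y ⊎ y ∈ R
      covered′ y y∈U with T? (covers x y)
      ... | yes x∋y = inj₁ (here x∋y)
      ... | no x∌y with covered y (∈-filter⁺ (λ y → ¬? (T? (covers x y))) y∈U x∌y)
      ...   | inj₁ c   = inj₁ (there c)
      ...   | inj₂ y∈R = inj₂ y∈R
      Q : ℕ
      Q = p + e
      U′ : List Y
      U′ = uncovered x U
      shrunk′ : Q ^ suc m * length R ≤ e ^ suc m * length U
      shrunk′ = begin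
        Q * Q ^ m * length R        ≡⟨ *-assoc Q (Q ^ m) (length R) ⟩
        Q * (Q ^ m * length R)      ≤⟨ *-monoʳ-≤ Q shrunk ⟩
        Q * (e ^ m * length U′)     ≡⟨ swap Q (e ^ m) (length U′) ⟩
        e ^ m * (Q * length U′)     ≤⟨ *-monoʳ-≤ (e ^ m) (uncovered-shrinks x U good) ⟩
        e ^ m * (e * length U)      ≡⟨ regroup (e ^ m) e (length U) ⟩
        e * e ^ m * length U        ∎
        where
        swap : ∀ a b c → a * (b * c) ≡ b * (a * c)
        swap = solve-∀
        regroup : ∀ a b c → a * (b * c) ≡ b * a * c
        regroup = solve-∀

    greedy-cover : ∀ m U → FractionallyCovered U → e ^ m * length U < (p + e) ^ m →
                   ∃[ L ] (length L ≤ m × ∀ y → y ∈ U → Covered L y)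
    greedy-cover m U hyp small with greedy m U hyp
    ... | L , [] , |L|≤m , covered , _ = L , |L|≤m , λ y y∈U → fromInj₁ (λ ()) (covered y y∈U)
    ... | L , y ∷ R , _ , _ , shrunk = ⊥-elim (<⇒≱ small (begin
      (p + e) ^ m                       ≤⟨ m≤m*n ((p + e) ^ m) (suc (length R)) ⟩
      (p + e) ^ m * suc (length R)      ≤⟨ shrunk ⟩
      e ^ m * length U                  ∎))
      where open ≤-Reasoning

_⊆ᵇ_ : ∀ {n} → Subset n → Subset n → Bool
[]      ⊆ᵇ []      = true
(s ∷ S) ⊆ᵇ (c ∷ C) = (not s ∨ c) ∧ (S ⊆ᵇ C)

⊆ᵇ-∁-disjoint : ∀ {n} (S U C : Subset n) → T (S ⊆ᵇ C) → T (U ⊆ᵇ ∁ C) → Empty (S ∩ U)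
⊆ᵇ-∁-disjoint (inside  ∷ S) (inside  ∷ U) (inside  ∷ C) _  () (zero , here)
⊆ᵇ-∁-disjoint (inside  ∷ S) (inside  ∷ U) (outside ∷ C) () _  (zero , here)
⊆ᵇ-∁-disjoint (inside  ∷ S) (outside ∷ U) (c ∷ C)       _  _  (zero , ())
⊆ᵇ-∁-disjoint (outside ∷ S) (u ∷ U)       (c ∷ C)       _  _  (zero , ())
⊆ᵇ-∁-disjoint (s ∷ S) (u ∷ U) (c ∷ C) S⊆C U⊆∁C (suc x , there x∈S∩U) =
  ⊆ᵇ-∁-disjoint S U C (proj₂ (Equivalence.to T-∧ S⊆C)) (proj₂ (Equivalence.to T-∧ U⊆∁C)) (x , x∈S∩U)

separates : ∀ {n} → Subset n → Subset n → Subset n → Bool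
separates S U c = (S ⊆ᵇ c) ∧ (U ⊆ᵇ ∁ c)

subsets≤ : ∀ n → ℕ → List (Subset n)
subsets≤ zero    m       = [] ∷ []
subsets≤ (suc n) zero    = map (outside ∷_) (subsets≤ n zero)
subsets≤ (suc n) (suc m) = map (outside ∷_) (subsets≤ n (suc m)) ++ map (inside ∷_) (subsets≤ n m)

∈-subsets≤ : ∀ {n} m (S : Subset n) → ∣ S ∣ ≤ m → S ∈ subsets≤ n m
∈-subsets≤ m       []            _         = here refl
∈-subsets≤ zero    (outside ∷ S) |S|≤0     = ∈-map⁺ (outside ∷_) (∈-subsets≤ zero S |S|≤0)
∈-subsets≤ (suc m) (outside ∷ S) |S|≤1+m   = ∈-++⁺ˡ (∈-map⁺ (outside ∷_) (∈-subsets≤ (suc m) S |S|≤1+m))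
∈-subsets≤ (suc m) (inside ∷ S)  (s≤s |S|≤m) =
  ∈-++⁺ʳ (map (outside ∷_) (subsets≤ _ (suc m))) (∈-map⁺ (inside ∷_) (∈-subsets≤ m S |S|≤m))

length-subsets≤ : ∀ n m → length (subsets≤ n m) ≤ suc n ^ m
length-subsets≤ zero    m       = ≤-reflexive (sym (^-zeroˡ m))
length-subsets≤ (suc n) zero    = ≤-trans (≤-reflexive (length-map (outside ∷_) (subsets≤ n zero))) (length-subsets≤ n zero)
length-subsets≤ (suc n) (suc m) = begin
  length (map (outside ∷_) (subsets≤ n (suc m)) ++ map (inside ∷_) (subsets≤ n m))
    ≡⟨ length-++ (map (outside ∷_) (subsets≤ n (suc m))) ⟩
  length (map (outside ∷_) (subsets≤ n (suc m))) + length (map (inside ∷_) (subsets≤ n m))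
    ≡⟨ cong₂ _+_ (length-map (outside ∷_) (subsets≤ n (suc m))) (length-map (inside ∷_) (subsets≤ n m)) ⟩
  length (subsets≤ n (suc m)) + length (subsets≤ n m)
    ≤⟨ +-mono-≤ (length-subsets≤ n (suc m)) (length-subsets≤ n m) ⟩
  suc n * suc n ^ m + suc n ^ m
    ≡⟨ +-comm (suc n * suc n ^ m) (suc n ^ m) ⟩
  suc (suc n) * suc n ^ m
    ≤⟨ *-monoʳ-≤ (suc (suc n)) (^-monoˡ-≤ m (n≤1+n (suc n))) ⟩
  suc (suc n) * suc (suc n) ^ m
    ∎
  where open ≤-Reasoning

-- A colouring c puts point i on the row side iff c i = inside.  The list colourings n
-- contains each c with multiplicity k^(#inside) ℓ^(#outside), so a uniform draw from it
-- colours the points independently, inside with probability k/(k+ℓ).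
module Colourings (k ℓ : ℕ) where

  palette : List Bool
  palette = replicate k inside ++ replicate ℓ outside

  colourings : ∀ n → List (Subset n)
  colourings zero    = [] ∷ []
  colourings (suc n) = cartesianProductWith _∷_ palette (colourings n)

  length-colourings : ∀ n → length (colourings n) ≡ (k + ℓ) ^ n
  length-colourings zero    = refl
  length-colourings (suc n) = begin
    length (colourings (suc n))              ≡⟨ length-cartesianProductWith _∷_ palette (colourings n) ⟩
    length palette * length (colourings n)   ≡⟨ cong₂ _*_ |palette| (length-colourings n) ⟩
    (k + ℓ) * (k + ℓ) ^ n                    ∎
    where
    open ≡-Reasoning
    |palette| : length palette ≡ k + ℓ
    |palette| = trans (length-++ (replicate k inside)) (cong₂ _+_ (length-replicate k) (length-replicate ℓ))

  countᵇ-palette : ∀ φ → countᵇ φ palette ≡ k * indicator (φ inside) + ℓ * indicator (φ outside)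
  countᵇ-palette φ = trans (countᵇ-++ φ (replicate k inside) _)
                           (cong₂ _+_ (countᵇ-replicate φ k inside) (countᵇ-replicate φ ℓ outside))

  countᵇ-separates-∷ : ∀ {n} s u (S U : Subset n) →
    countᵇ (separates (s ∷ S) (u ∷ U)) (colourings (suc n))
      ≡ countᵇ (λ b → (not s ∨ b) ∧ (not u ∨ not b)) palette * countᵇ (separates S U) (colourings n)
  countᵇ-separates-∷ s u S U =
    countᵇ-cartesianProductWith _∷_ (separates (s ∷ S) (u ∷ U)) (λ b → (not s ∨ b) ∧ (not u ∨ not b))
      (separates S U) (λ b c → ∧-∧-interchange (not s ∨ b) (S ⊆ᵇ c) (not u ∨ not b) (U ⊆ᵇ ∁ c))
      palette (colourings _)

  separating-colourings : ∀ {n} (S U : Subset n) → Empty (S ∩ U) →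
    countᵇ (separates S U) (colourings n) * (k + ℓ) ^ (∣ S ∣ + ∣ U ∣) ≡ (k + ℓ) ^ n * k ^ ∣ S ∣ * ℓ ^ ∣ U ∣
  separating-colourings [] [] _ = refl
  separating-colourings {suc n} (s ∷ S) (u ∷ U) disjoint = begin
    countᵇ (separates (s ∷ S) (u ∷ U)) (colourings (suc n)) * D ^ (∣ s ∷ S ∣ + ∣ u ∷ U ∣)
      ≡⟨ cong (_* D ^ (∣ s ∷ S ∣ + ∣ u ∷ U ∣)) (trans (countᵇ-separates-∷ s u S U) (cong (_* c) (countᵇ-palette _))) ⟩
    weight s u * c * D ^ (∣ s ∷ S ∣ + ∣ u ∷ U ∣)
      ≡⟨ extend s u disjoint ⟩
    D * D ^ n * k ^ ∣ s ∷ S ∣ * ℓ ^ ∣ u ∷ U ∣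
      ∎
    where
    open ≡-Reasoning
    D a b c : ℕ
    D = k + ℓ
    a = ∣ S ∣
    b = ∣ U ∣
    c = countᵇ (separates S U) (colourings n)
    ih : c * D ^ (a + b) ≡ D ^ n * k ^ a * ℓ ^ b
    ih = separating-colourings S U (drop-∷-Empty disjoint)
    weight : Bool → Bool → ℕ
    weight s u = k * indicator ((not s ∨ inside) ∧ (not u ∨ not inside))
               + ℓ * indicator ((not s ∨ outside) ∧ (not u ∨ not outside))
    extend : ∀ s u → Empty ((s ∷ S) ∩ (u ∷ U)) →
             weight s u * c * D ^ (∣ s ∷ S ∣ + ∣ u ∷ U ∣) ≡ D * D ^ n * k ^ ∣ s ∷ S ∣ * ℓ ^ ∣ u ∷ U ∣
    extend outside outside _ = trans (regroup k ℓ c (D ^ (a + b))) (trans (cong (D *_) ih) (assoc D (D ^ n) (k ^ a) (ℓ ^ b)))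
      where
      regroup : ∀ k ℓ c E → (k * 1 + ℓ * 1) * c * E ≡ (k + ℓ) * (c * E)
      regroup = solve-∀
      assoc : ∀ x y z w → x * (y * z * w) ≡ x * y * z * w
      assoc = solve-∀
    extend inside outside _ = trans (regroup k ℓ c D (D ^ (a + b))) (trans (cong (k * D *_) ih) (reassoc k D (D ^ n) (k ^ a) (ℓ ^ b)))
      where
      regroup : ∀ k ℓ c D E → (k * 1 + ℓ * 0) * c * (D * E) ≡ k * D * (c * E)
      regroup = solve-∀
      reassoc : ∀ k D N K L → k * D * (N * K * L) ≡ D * N * (k * K) * L
      reassoc = solve-∀
    extend outside inside _ = begin
      (k * 0 + ℓ * 1) * c * D ^ (a + suc b)    ≡⟨ cong (λ m → (k * 0 + ℓ * 1) * c * D ^ m) (+-suc a b) ⟩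
      (k * 0 + ℓ * 1) * c * (D * D ^ (a + b))  ≡⟨ regroup k ℓ c D (D ^ (a + b)) ⟩
      ℓ * D * (c * D ^ (a + b))                ≡⟨ cong (ℓ * D *_) ih ⟩
      ℓ * D * (D ^ n * k ^ a * ℓ ^ b)          ≡⟨ reassoc ℓ D (D ^ n) (k ^ a) (ℓ ^ b) ⟩
      D * D ^ n * k ^ a * (ℓ * ℓ ^ b)          ∎
      where
      regroup : ∀ k ℓ c D E → (k * 0 + ℓ * 1) * c * (D * E) ≡ ℓ * D * (c * E)
      regroup = solve-∀
      reassoc : ∀ ℓ D N K L → ℓ * D * (N * K * L) ≡ D * N * K * (ℓ * L)
      reassoc = solve-∀
    extend inside inside disjoint = ⊥-elim (disjoint (zero , here))

  separating-colourings-≥ : ∀ {n} (S U : Subset n) → Empty (S ∩ U) → ∣ S ∣ ≤ k → ∣ U ∣ ≤ ℓ →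
    length (colourings n) * (k ^ k * ℓ ^ ℓ) ≤ (k + ℓ) ^ (k + ℓ) * countᵇ (separates S U) (colourings n)
  separating-colourings-≥ {n} S U disjoint |S|≤k |U|≤ℓ = begin
    length (colourings n) * (k ^ k * ℓ ^ ℓ)
      ≡⟨ cong₂ (λ x y → length (colourings n) * (k ^ x * ℓ ^ y)) (m+[n∸m]≡n |S|≤k) (m+[n∸m]≡n |U|≤ℓ) ⟨
    length (colourings n) * (k ^ (a + a′) * ℓ ^ (b + b′))
      ≡⟨ cong₂ _*_ (length-colourings n) (cong₂ _*_ (^-distribˡ-+-* k a a′) (^-distribˡ-+-* ℓ b b′)) ⟩
    D ^ n * (k ^ a * k ^ a′ * (ℓ ^ b * ℓ ^ b′))
      ≡⟨ regroup (D ^ n) (k ^ a) (k ^ a′) (ℓ ^ b) (ℓ ^ b′) ⟩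
    D ^ n * k ^ a * ℓ ^ b * (k ^ a′ * ℓ ^ b′)
      ≡⟨ cong (_* (k ^ a′ * ℓ ^ b′)) (separating-colourings S U disjoint) ⟨
    c * D ^ (a + b) * (k ^ a′ * ℓ ^ b′)
      ≤⟨ *-monoʳ-≤ (c * D ^ (a + b)) (*-mono-≤ (^-monoˡ-≤ a′ (m≤m+n k ℓ)) (^-monoˡ-≤ b′ (m≤n+m ℓ k))) ⟩
    c * D ^ (a + b) * (D ^ a′ * D ^ b′)
      ≡⟨ cong (λ x → c * D ^ (a + b) * x) (^-distribˡ-+-* D a′ b′) ⟨
    c * D ^ (a + b) * D ^ (a′ + b′)
      ≡⟨ *-assoc c (D ^ (a + b)) _ ⟩
    c * (D ^ (a + b) * D ^ (a′ + b′))
      ≡⟨ cong (c *_) (^-distribˡ-+-* D (a + b) (a′ + b′)) ⟨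
    c * D ^ (a + b + (a′ + b′))
      ≡⟨ cong (λ x → c * D ^ x) (trans (+-interchange a b a′ b′) (cong₂ _+_ (m+[n∸m]≡n |S|≤k) (m+[n∸m]≡n |U|≤ℓ))) ⟩
    c * D ^ (k + ℓ)
      ≡⟨ *-comm c (D ^ (k + ℓ)) ⟩
    D ^ (k + ℓ) * c
      ∎
    where
    open ≤-Reasoning
    D a b a′ b′ c : ℕ
    D  = k + ℓ
    a  = ∣ S ∣
    b  = ∣ U ∣
    a′ = k ∸ a
    b′ = ℓ ∸ b
    c  = countᵇ (separates S U) (colourings n)
    regroup : ∀ N x x′ y y′ → N * (x * x′ * (y * y′)) ≡ N * x * y * (x′ * y′)
    regroup = solve-∀

rectangle : ∀ {n} → ℕ → ℕ → Subset n → Rect n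
rectangle k ℓ c = rect (λ S → (S ⊆ᵇ c) ∧ (∣ S ∣ ≤ᵇ k)) (λ U → (U ⊆ᵇ ∁ c) ∧ (∣ U ∣ ≤ᵇ ℓ))

rectangle⊆supp : ∀ {n k ℓ} (c S U : Subset n) → InRect (rectangle k ℓ c) S U → Supp n k ℓ S U
rectangle⊆supp {k = k} {ℓ} c S U (S-row , U-col) with Equivalence.to T-∧ S-row | Equivalence.to T-∧ U-col
... | S⊆c , |S|≤k | U⊆∁c , |U|≤ℓ = ≤ᵇ⇒≤ (∣ S ∣) k |S|≤k , ≤ᵇ⇒≤ (∣ U ∣) ℓ |U|≤ℓ , ⊆ᵇ-∁-disjoint S U c S⊆c U⊆∁c

separates⇒∈rectangle : ∀ {n k ℓ} (c S U : Subset n) → T (separates S U c) → Supp n k ℓ S U →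
                       InRect (rectangle k ℓ c) S U
separates⇒∈rectangle c S U sep (|S|≤k , |U|≤ℓ , _) with Equivalence.to T-∧ sep
... | S⊆c , U⊆∁c = Equivalence.from T-∧ (S⊆c , ≤⇒≤ᵇ |S|≤k) , Equivalence.from T-∧ (U⊆∁c , ≤⇒≤ᵇ |U|≤ℓ)

rectangles-cover : ∀ {n k ℓ} (cs : List (Subset n)) →
                   (∀ S U → Supp n k ℓ S U → Any (λ c → T (separates S U c)) cs) →
                   IsRectCovering n k ℓ (map (rectangle k ℓ) cs)
rectangles-cover {k = k} {ℓ} cs separated = sound , complete
  where
  sound : ∀ R → R ∈ map (rectangle k ℓ) cs → ∀ S U → InRect R S U → Supp _ k ℓ S U
  sound R R∈rs S U S×U∈R with ∈-map⁻ (rectangle k ℓ) R∈rs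
  ... | c , _ , refl = rectangle⊆supp c S U S×U∈R
  complete : ∀ S U → Supp _ k ℓ S U → ∃[ R ] (R ∈ map (rectangle k ℓ) cs × InRect R S U)
  complete S U supp = go (separated S U supp)
    where
    go : ∀ {cs} → Any (λ c → T (separates S U c)) cs → ∃[ R ] (R ∈ map (rectangle k ℓ) cs × InRect R S U)
    go (here {c} sep) = rectangle k ℓ c , here refl , separates⇒∈rectangle c S U sep supp
    go (there any)    with go any
    ... | R , R∈rs , S×U∈R = R , there R∈rs , S×U∈R

module Construction (n k ℓ : ℕ) (1≤ℓ : 1 ≤ ℓ) (ℓ≤k : ℓ ≤ k) (2≤n : 2 ≤ n) where
  open Colourings k ℓ

  p Q e : ℕ
  p = k ^ k * ℓ ^ ℓ
  Q = (k + ℓ) ^ (k + ℓ)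
  e = Q ∸ p

  instance
    p≢0 : NonZero p
    p≢0 = m*n≢0 (k ^ k) (ℓ ^ ℓ) {{m^n≢0 k k {{>-nonZero (≤-trans 1≤ℓ ℓ≤k)}}}} {{m^n≢0 ℓ ℓ {{>-nonZero 1≤ℓ}}}}
    |colourings|≢0 : NonZero (length (colourings n))
    |colourings|≢0 = subst NonZero (sym (length-colourings n))
                           (m^n≢0 (k + ℓ) n {{>-nonZero (≤-trans 1≤ℓ (m≤n+m ℓ k))}})

  p≤Q : p ≤ Q
  p≤Q = begin
    k ^ k * ℓ ^ ℓ               ≤⟨ *-mono-≤ (^-monoˡ-≤ k (m≤m+n k ℓ)) (^-monoˡ-≤ ℓ (m≤n+m ℓ k)) ⟩
    (k + ℓ) ^ k * (k + ℓ) ^ ℓ   ≡⟨ ^-distribˡ-+-* (k + ℓ) k ℓ ⟨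
    (k + ℓ) ^ (k + ℓ)           ∎
    where open ≤-Reasoning

  p+e≡Q : p + e ≡ Q
  p+e≡Q = m+[n∸m]≡n p≤Q

  supp? : (y : Subset n × Subset n) → Dec (Supp n k ℓ (proj₁ y) (proj₂ y))
  supp? (S , U) = ∣ S ∣ ≤? k ×-dec ∣ U ∣ ≤? ℓ ×-dec ¬? (nonempty? (S ∩ U))

  candidates supportEntries : List (Subset n × Subset n)
  candidates     = cartesianProduct (subsets≤ n k) (subsets≤ n ℓ)
  supportEntries = filter supp? candidates

  open GreedyCover (λ c y → separates (proj₁ y) (proj₂ y) c) (colourings n) p e

  supportEntries-fractionallyCovered : FractionallyCovered supportEntries
  supportEntries-fractionallyCovered (S , U) S×U∈entries
    with |S|≤k , |U|≤ℓ , disjoint ← proj₂ (∈-filter⁻ supp? {xs = candidates} S×U∈entries) =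
    subst (λ x → length (colourings n) * p ≤ x * degree (S , U)) (sym p+e≡Q)
          (separating-colourings-≥ S U disjoint |S|≤k |U|≤ℓ)

  -- A greedy round shrinks the uncovered entries by the factor e/Q ≤ 1 - 1/rounds, so
  -- rounds rounds halve them, and height halvings exhaust all entries.
  L rounds height : ℕ
  L      = ⌊log₂ n ⌋
  rounds = suc (Q / p)
  height = (k + ℓ) * suc L + 1

  |supportEntries|<2^height : length supportEntries < 2 ^ height
  |supportEntries|<2^height = begin-strict
    length supportEntries                            ≤⟨ length-filter supp? candidates ⟩
    length candidates                                ≡⟨ length-cartesianProductWith _,_ (subsets≤ n k) (subsets≤ n ℓ) ⟩
    length (subsets≤ n k) * length (subsets≤ n ℓ)    ≤⟨ *-mono-≤ (length-subsets≤ n k) (length-subsets≤ n ℓ) ⟩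
    suc n ^ k * suc n ^ ℓ                            ≡⟨ ^-distribˡ-+-* (suc n) k ℓ ⟨
    suc n ^ (k + ℓ)                                  ≤⟨ ^-monoˡ-≤ (k + ℓ) (n<2^[1+⌊log₂n⌋] n) ⟩
    (2 ^ suc L) ^ (k + ℓ)                            ≡⟨ ^-*-assoc 2 (suc L) (k + ℓ) ⟩
    2 ^ (suc L * (k + ℓ))                            ≡⟨ cong (2 ^_) (*-comm (suc L) (k + ℓ)) ⟩
    2 ^ ((k + ℓ) * suc L)                            <⟨ ^-monoʳ-< 2 (s≤s (s≤s z≤n)) (m<m+n ((k + ℓ) * suc L) (s≤s z≤n)) ⟩
    2 ^ height                                       ∎
    where open ≤-Reasoning

  cover : ∃[ cs ] (length cs ≤ rounds * height × ∀ y → y ∈ supportEntries → Covered cs y)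
  cover = greedy-cover (rounds * height) supportEntries supportEntries-fractionallyCovered
            (e^[r*h]*u<[p+e]^[r*h] rounds height 1≤p+e p+e≤rounds*p |supportEntries|<2^height)
    where
    1≤p+e : 1 ≤ p + e
    1≤p+e = ≤-trans (>-nonZero⁻¹ p) (m≤m+n p e)
    p+e≤rounds*p : p + e ≤ rounds * p
    p+e≤rounds*p = subst (_≤ rounds * p) (sym p+e≡Q) (<⇒≤ (m<[1+m/n]*n Q p))

  rectangles : List (Rect n)
  rectangles = map (rectangle k ℓ) (proj₁ cover)

  rectangles-isCovering : IsRectCovering n k ℓ rectangles
  rectangles-isCovering = rectangles-cover (proj₁ cover) λ S U supp@(|S|≤k , |U|≤ℓ , _) →
    proj₂ (proj₂ cover) (S , U)
      (∈-filter⁺ supp? (∈-cartesianProduct⁺ (∈-subsets≤ k S |S|≤k) (∈-subsets≤ ℓ U |U|≤ℓ)) supp)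

  rectangles-size : length rectangles * ℓ ^ (ℓ * ℓ + ℓ)
                      ≤ 24 * ((k + ℓ) * (ℓ + 1) ^ (ℓ * ℓ) * (k + ℓ) ^ ℓ * L)
  rectangles-size = begin
    length rectangles * ℓ ^ (ℓ * ℓ + ℓ)     ≡⟨ cong (_* ℓ ^ (ℓ * ℓ + ℓ)) (length-map (rectangle k ℓ) (proj₁ cover)) ⟩
    length (proj₁ cover) * ℓ ^ (ℓ * ℓ + ℓ)  ≤⟨ *-monoˡ-≤ (ℓ ^ (ℓ * ℓ + ℓ)) (proj₁ (proj₂ cover)) ⟩
    rounds * height * ℓ ^ (ℓ * ℓ + ℓ)       ≤⟨ rounds*height-bound {r = rounds} 1≤ℓ ℓ≤k rounds*p≤2Q height≤3[k+ℓ]L ⟩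
    24 * ((k + ℓ) * (ℓ + 1) ^ (ℓ * ℓ) * (k + ℓ) ^ ℓ * L) ∎
    where
    open ≤-Reasoning
    rounds*p≤2Q : rounds * p ≤ 2 * Q
    rounds*p≤2Q = begin
      rounds * p   ≤⟨ [1+m/n]*n≤n+m Q p ⟩
      p + Q        ≤⟨ +-monoˡ-≤ Q p≤Q ⟩
      Q + Q        ≡⟨ cong (Q +_) (+-identityʳ Q) ⟨
      2 * Q        ∎
    height≤3[k+ℓ]L : height ≤ 3 * ((k + ℓ) * L)
    height≤3[k+ℓ]L = m*[1+n]+1≤3*[m*n] (≤-trans 1≤ℓ (m≤n+m ℓ k)) (1≤⌊log₂n⌋ 2≤n)

lemma3p3 : ∃[ C ] ∀ (n k ℓ : ℕ) → 1 ≤ ℓ → ℓ ≤ k → k ≤ n → 2 ≤ n →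
    ∃[ rs ] (IsRectCovering n k ℓ rs ×
    length rs * ℓ ^ (ℓ * ℓ + ℓ)
    ≤ C * ((k + ℓ) * (ℓ + 1) ^ (ℓ * ℓ) * (k + ℓ) ^ ℓ * ⌊log₂ n ⌋))
lemma3p3 = 24 , λ n k ℓ 1≤ℓ ℓ≤k _ 2≤n →
  let open Construction n k ℓ 1≤ℓ ℓ≤k 2≤n in rectangles , rectangles-isCovering , rectangles-size
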